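{- Assume the univalence axiom. Then homotopy-initial $P$-algebras are unique up to a contractible type of paths: the type $(\Pi C:\mathsf{Alg})(\Pi D:\mathsf{Alg})\big(\mathsf{ishinit}(C)\times\mathsf{ishinit}(D)\to\mathsf{iscontr}(\mathsf{Id}_{\mathsf{Alg}}(C,D))\big)$ is inhabited.
   Context: Work in the intensional Martin-Löf type theory $\mathcal{H}$ with $\Sigma$-types, $\Pi$-types (with judgemental $\eta$), identity types, a universe $\mathsf{U}$ closed under $\Sigma,\Pi,\mathsf{Id}$, and function extensionality; no UIP. $\mathsf{iscontr}(X):=(\Sigma x:X)(\Pi y:X)\mathsf{Id}(x,y)$. Univalence axiom: for all $X,Y:\mathsf{U}$ the canonical map from $\mathsf{Id}_{\mathsf{U}}(X,Y)$ to the type of equivalences $X\to Y$ (functions with contractible homotopy fibers) is an equivalence. Fix $A:\mathsf{U}$, $B:A\to\mathsf{U}$; $PC:=(\Sigma x:A)(B(x)\to C)$, $Pf(x,u)=(x,f\circ u)$. $\mathsf{Alg}:=(\Sigma C:\mathsf{U})(PC\to C)$; $\mathsf{Alg}(C,D):=(\Sigma f:C\to D)\mathsf{Id}(f\circ\sup_C,\sup_D\circ Pf)$; $\mathsf{ishinit}(C):=(\Pi D:\mathsf{Alg})\mathsf{iscontr}(\mathsf{Alg}(C,D))$. -}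

{-# OPTIONS --without-K #-}
module Defs where

open import Level using (Level; _⊔_; Setω) renaming (suc to lsuc; zero to lzero)
open import Data.Product using (Σ; _×_; _,_; proj₁; proj₂)
open import Relation.Binary.PropositionalEquality using (_≡_; refl)
open import Function using (_∘_; id)

iscontr : ∀ {ℓ} → Set ℓ → Set ℓ
iscontr X = Σ X (λ x → (y : X) → x ≡ y)

fib : ∀ {a b} {X : Set a} {Y : Set b} → (X → Y) → Y → Set (a ⊔ b)
fib {X = X} f y = Σ X (λ x → f x ≡ y)

isEquiv : ∀ {a b} {X : Set a} {Y : Set b} → (X → Y) → Set (a ⊔ b)
isEquiv {Y = Y} f = (y : Y) → iscontr (fib f y)

Equiv : ∀ {a b} → Set a → Set b → Set (a ⊔ b)
Equiv X Y = Σ (X → Y) isEquiv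

id-isEquiv : ∀ {a} (X : Set a) → isEquiv (id {A = X})
id-isEquiv X y = (y , refl) , λ { (x , refl) → refl }

idtoeqv : (X Y : Set) → X ≡ Y → Equiv X Y
idtoeqv X .X refl = id , id-isEquiv X

Univalence : Set₁
Univalence = (X Y : Set) → isEquiv (idtoeqv X Y)

-- Function extensionality (part of the ambient theory H), at all levels
FunExt : Setω
FunExt = ∀ {a b} {X : Set a} {Y : X → Set b} (f g : (x : X) → Y x)
         → ((x : X) → f x ≡ g x) → f ≡ g

module _ (A : Set) (B : A → Set) where

  P : Set → Set
  P C = Σ A (λ x → B x → C)

  Pmap : {C D : Set} → (C → D) → P C → P D
  Pmap f (x , u) = x , f ∘ u

  Alg : Set₁
  Alg = Σ Set (λ C → P C → C)

  AlgHom : Alg → Alg → Set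
  AlgHom (C , supC) (D , supD) =
    Σ (C → D) (λ f → (f ∘ supC) ≡ (supD ∘ Pmap f))

  ishinit : Alg → Set₁
  ishinit C = (D : Alg) → iscontr (AlgHom C D)

{-# OPTIONS --without-K #-}
module Submission where

-- Univalence makes the type of algebras C ≡ D a retract of the type of algebra
-- equivalences C ≃ D: for fixed C the pairs (D , C ≃ D) form a contractible type
-- (the structure identity principle), with centre (C , id).  Between two
-- homotopy-initial algebras every homomorphism f is an equivalence, its inverse being
-- the unique homomorphism g back, since g ∘ f and f ∘ g are endomorphisms of
-- homotopy-initial algebras and hence the identity.  Being an equivalence is a
-- proposition, so C ≃ D is as contractible as the type of homomorphisms C → D,
-- and therefore so is C ≡ D.

open import Level using (Level)
open import Data.Product using (Σ; _×_; _,_; proj₁; proj₂)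
open import Function using (_∘_; id)
open import Relation.Binary.PropositionalEquality
  using (_≡_; refl; sym; trans; cong; cong-app; subst)
open import Relation.Binary.PropositionalEquality.Properties using (trans-symˡ)
open import Relation.Nullary.Irrelevant using (Irrelevant)

open import Defs

private
  variable
    a b : Level
    X : Set a
    Y : Set b

retract-iscontr : (r : Y → X) (s : X → Y) → (∀ x → r (s x) ≡ x) → iscontr Y → iscontr X
retract-iscontr r s r∘s≗id (c , h) = r c , λ x → trans (cong r (h (s x))) (r∘s≗id x)

singleton-iscontr : (y : X) → iscontr (Σ X (_≡ y))
singleton-iscontr y = (y , refl) , λ { (z , refl) → refl }

iscontr⇒≡ : iscontr X → (x y : X) → x ≡ y
iscontr⇒≡ (c , h) x y = trans (sym (h x)) (h y)

iscontr⇒≡-refl : (cX : iscontr X) (x : X) → iscontr⇒≡ cX x x ≡ refl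
iscontr⇒≡-refl (c , h) x = trans-symˡ (h x)

iscontr⇒≡-canonical : (cX : iscontr X) {x y : X} (p : x ≡ y) → p ≡ iscontr⇒≡ cX x y
iscontr⇒≡-canonical cX {x} refl = sym (iscontr⇒≡-refl cX x)

iscontr⇒≡-irrelevant : iscontr X → {x y : X} → Irrelevant (x ≡ y)
iscontr⇒≡-irrelevant cX p q =
  trans (iscontr⇒≡-canonical cX p) (sym (iscontr⇒≡-canonical cX q))

Σ-iscontr : {Q : X → Set b} → (∀ x → Irrelevant (Q x))
          → (cX : iscontr X) → Q (proj₁ cX) → iscontr (Σ X Q)
Σ-iscontr {X = X} {Q = Q} Q-irrelevant (c , h) q = (c , q) , λ (x , q′) → go (h x) q′
  where
  go : {x : X} (p : c ≡ x) (q′ : Q x) → (c , q) ≡ (x , q′)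
  go refl q′ = cong (c ,_) (Q-irrelevant c q q′)

-- Fundamental theorem of identity types, in the form of a retraction.
≡-iscontr-from-total : {R : X → Set b} {c : X} (r₀ : R c) → iscontr (Σ X R)
                     → {y : X} → iscontr (R y) → iscontr (c ≡ y)
≡-iscontr-from-total {X = X} {R = R} {c} r₀ total {y} = retract-iscontr from to from∘to
  where
  to : {y : X} → c ≡ y → R y
  to refl = r₀
  from : R y → c ≡ y
  from r = cong proj₁ (iscontr⇒≡ total (c , r₀) (y , r))
  from∘to : (p : c ≡ y) → from (to p) ≡ p
  from∘to refl = cong (cong proj₁) (iscontr⇒≡-refl total (c , r₀))

-- The fibre over y is a retract of Σ z (f (g z) ≡ y), which f ∘ g ≗ id identifies with
-- the singleton at y.
qinv⇒isEquiv : (f : X → Y) (g : Y → X)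
             → (∀ x → g (f x) ≡ x) → (∀ y → f (g y) ≡ y) → isEquiv f
qinv⇒isEquiv {X = X} {Y = Y} f g g∘f≗id f∘g≗id y =
  retract-iscontr fromΣ toΣ fromΣ∘toΣ Σ-f∘g-iscontr
  where
  FΣ : Set _
  FΣ = Σ Y (λ z → f (g z) ≡ y)

  trans-cancel : {u v w : Y} (p : u ≡ v) (q : u ≡ w) → trans p (trans (sym p) q) ≡ q
  trans-cancel refl q = refl

  Σ-f∘g-iscontr : iscontr FΣ
  Σ-f∘g-iscontr =
    retract-iscontr (λ (z , q) → z , trans (f∘g≗id z) q)
                    (λ (z , q) → z , trans (sym (f∘g≗id z)) q)
                    (λ (z , q) → cong (z ,_) (trans-cancel (f∘g≗id z) q))
                    (singleton-iscontr y)

  fromΣ : FΣ → fib f y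
  fromΣ (z , q) = g z , q

  toΣ : fib f y → FΣ
  toΣ (x , p) = f x , trans (cong f (g∘f≗id x)) p

  fib-≡ : {x′ x : X} (e : x′ ≡ x) (p : f x ≡ y) → _≡_ {A = fib f y} (x′ , trans (cong f e) p) (x , p)
  fib-≡ refl p = refl

  fromΣ∘toΣ : ∀ w → fromΣ (toΣ w) ≡ w
  fromΣ∘toΣ (x , p) = fib-≡ (g∘f≗id x) p

module _ (fe : FunExt) where

  iscontr-irrelevant : Irrelevant (iscontr X)
  iscontr-irrelevant {X = X} (c , h) (c′ , h′) = go (h c′) h′
    where
    go : {d : X} (p : c ≡ d) (k : ∀ y → d ≡ y) → (c , h) ≡ (d , k)
    go refl k = cong (c ,_) (fe h k λ y → iscontr⇒≡-irrelevant (c , h) (h y) (k y))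

  isEquiv-irrelevant : (f : X → Y) → Irrelevant (isEquiv f)
  isEquiv-irrelevant f u v = fe u v λ y → iscontr-irrelevant (u y) (v y)

Σ-Equiv-iscontr : Univalence → (X : Set) → iscontr (Σ Set (Equiv X))
Σ-Equiv-iscontr ua X = (X , idtoeqv X X refl) , λ (Y , e) → from-fib Y e (proj₁ (ua X Y e))
  where
  from-fib : ∀ Y e → fib (idtoeqv X Y) e → _≡_ {A = Σ Set (Equiv X)} (X , idtoeqv X X refl) (Y , e)
  from-fib Y e (refl , q) = cong (X ,_) q

module _ (A : Set) (B : A → Set) where

  idᴬ : (C : Alg A B) → AlgHom A B C C
  idᴬ C = id , refl

  ∘ᴬ : (C D E : Alg A B) → AlgHom A B D E → AlgHom A B C D → AlgHom A B C E
  ∘ᴬ _ _ _ (g , g-hom) (f , f-hom) = g ∘ f , trans (cong (g ∘_) f-hom) (cong (_∘ Pmap A B f) g-hom)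

  AlgEquiv : Alg A B → Alg A B → Set
  AlgEquiv C D = Σ (AlgHom A B C D) (isEquiv ∘ proj₁)

  AlgEquiv-refl : (C : Alg A B) → AlgEquiv C C
  AlgEquiv-refl C = idᴬ C , id-isEquiv (proj₁ C)

  -- Univalence contracts the pair (carrier , equivalence); what is left of an algebra
  -- equivalence out of (C , s) is a structure map t with a path f ∘ s ≡ t ∘ P f, a singleton.
  Σ-AlgEquiv-iscontr : Univalence → (C : Alg A B) → iscontr (Σ (Alg A B) (AlgEquiv C))
  Σ-AlgEquiv-iscontr ua (C , s) =
    centre , λ ((D , t) , ((f , f-hom) , f-equiv)) →
      subst Q (proj₂ (Σ-Equiv-iscontr ua C) (D , f , f-equiv)) centre-Q t f-hom
    where
    centre : Σ (Alg A B) (AlgEquiv (C , s))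
    centre = (C , s) , AlgEquiv-refl (C , s)
    Q : Σ Set (Equiv C) → Set₁
    Q (D , f , f-equiv) = (t : P A B D → D) (f-hom : f ∘ s ≡ t ∘ Pmap A B f)
                        → centre ≡ ((D , t) , ((f , f-hom) , f-equiv))
    centre-Q : Q (C , idtoeqv C C refl)
    centre-Q t refl = refl

  ishinit-endo≗id : {C : Alg A B} → ishinit A B C → (f : AlgHom A B C C) → ∀ x → proj₁ f x ≡ x
  ishinit-endo≗id {C} hC f = cong-app (cong proj₁ (iscontr⇒≡ (hC C) f (idᴬ C)))

  ishinit-hom-isEquiv : {C D : Alg A B} → ishinit A B C → ishinit A B D
                      → (f : AlgHom A B C D) → isEquiv (proj₁ f)
  ishinit-hom-isEquiv {C} {D} hC hD f =
    qinv⇒isEquiv (proj₁ f) (proj₁ g) (ishinit-endo≗id hC (∘ᴬ C D C g f))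
                                     (ishinit-endo≗id hD (∘ᴬ D C D f g))
    where
    g : AlgHom A B D C
    g = proj₁ (hD C)

  ishinit-AlgEquiv-iscontr : FunExt → {C D : Alg A B} → ishinit A B C → ishinit A B D
                           → iscontr (AlgEquiv C D)
  ishinit-AlgEquiv-iscontr fe {C} {D} hC hD =
    Σ-iscontr (λ f → isEquiv-irrelevant fe (proj₁ f)) (hC D)
              (ishinit-hom-isEquiv {C} {D} hC hD (proj₁ (hC D)))

corollary5p16 : FunExt → Univalence → (A : Set) (B : A → Set)
    → (C D : Alg A B) → ishinit A B C × ishinit A B D → iscontr (C ≡ D)
corollary5p16 fe ua A B C D (hC , hD) =
  ≡-iscontr-from-total (AlgEquiv-refl A B C) (Σ-AlgEquiv-iscontr A B ua C)
                       (ishinit-AlgEquiv-iscontr A B fe hC hD)
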